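{- For each $G\in\mathscr{B}$, $\operatorname{diam}(G)=\operatorname{diam}(T_G)$, where $T_G$ is the associated subgraph of $G$.
   Context: All graphs are finite, simple and connected. A block is a maximal connected subgraph without a cut-vertex; $C_G$ is the set of cut-vertices of $G$. A bi-block graph is a connected graph all of whose blocks are complete bipartite graphs. $\mathscr{B}$ is the class of bi-block graphs with at least two blocks in which every block contains at most two cut-vertices of $G$. For a block $B$, $(V_1(B),V_2(B))$ is its bipartition; $B$ is a leaf block if $|V_B\cap C_G|=1$. Vertices of $G$ are labelled $v_1,\dots,v_n$. Construction of $T_G$: for a block $B$ and $i=1,2$, let $u_i$ be the non-cut-vertex of minimum label in $V_i(B)$, if it exists. If $B\neq K_{1,1}$: $NC_B=\{u_2\}$ if $|V_1(B)\cap C_G|=2$; $NC_B=\{u_1\}$ if $|V_2(B)\cap C_G|=2$; $NC_B=\{u_1,u_2\}$ if $B$ is a leaf block; $NC_B=\emptyset$ otherwise. If $B=K_{1,1}$: $NC_B=\{u_1,u_2\}\cap V_B$. $T_G$ is the subgraph of $G$ induced by $\bigcup_B NC_B\cup C_G$. $\operatorname{diam}$ denotes the diameter (maximum distance between two vertices). -}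

module Defs where

open import Data.Nat using (ℕ; zero; suc; _≤_; _<_)
open import Data.Fin using (Fin) renaming (_≤_ to _≤ᶠ_)
open import Data.Fin.Subset using (Subset; _∈_; _∉_; _⊆_)
open import Data.Product using (Σ; ∃; ∃₂; _×_; _,_)
open import Data.Sum using (_⊎_)
open import Data.Unit using (⊤)
open import Relation.Nullary using (¬_; Dec)
open import Relation.Binary.PropositionalEquality using (_≡_; _≢_)

-- A finite simple graph on the vertex set Fin n; the label of vertex v_i is
-- its position in Fin n (labels are compared with the order on Fin n).
record Graph (n : ℕ) : Set₁ where
  field
    E     : Fin n → Fin n → Set
    E?    : ∀ u v → Dec (E u v)
    E-sym : ∀ {u v} → E u v → E v u
    E-irr : ∀ {u} → ¬ E u u

VPred : ℕ → Set₁
VPred n = Fin n → Set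

ExactlyOne : ∀ {n} → VPred n → Set
ExactlyOne P = ∃ λ a → P a × (∀ w → P w → w ≡ a)

ExactlyTwo : ∀ {n} → VPred n → Set
ExactlyTwo P = ∃₂ λ a b → a ≢ b × P a × P b × (∀ w → P w → w ≡ a ⊎ w ≡ b)

AtMostTwo : ∀ {n} → VPred n → Set
AtMostTwo P = ∃₂ λ a b → ∀ w → P w → w ≡ a ⊎ w ≡ b

module _ {n : ℕ} (G : Graph n) where
  open Graph G

  data Walk (S : VPred n) : Fin n → Fin n → ℕ → Set where
    here : ∀ {u} → S u → Walk S u u zero
    step : ∀ {u w v k} → S u → E u w → Walk S w v k → Walk S u v (suc k)

  Connected : VPred n → Set
  Connected S = ∀ u v → S u → S v → ∃ λ k → Walk S u v k

  AllV : VPred n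
  AllV _ = ⊤

  IsCut : Fin n → Set
  IsCut v = ¬ Connected (λ w → w ≢ v)

  BlockLike : Subset n → Set
  BlockLike B = (∃ λ v → v ∈ B) × Connected (_∈ B)
              × (∀ v → v ∈ B → Connected (λ w → w ∈ B × w ≢ v))

  IsBlock : Subset n → Set
  IsBlock B = BlockLike B × (∀ B' → B ⊆ B' → BlockLike B' → B' ⊆ B)

  IsBipartition : Subset n → Subset n → Subset n → Set
  IsBipartition B V1 V2 =
      (∀ v → v ∈ B → v ∈ V1 ⊎ v ∈ V2)
    × (∀ v → v ∈ V1 → v ∈ B) × (∀ v → v ∈ V2 → v ∈ B)
    × (∀ v → v ∈ V1 → v ∉ V2)
    × (∃ λ v → v ∈ V1) × (∃ λ v → v ∈ V2)
    × (∀ a b → a ∈ V1 → b ∈ V2 → E a b)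
    × (∀ a b → a ∈ V1 → b ∈ V1 → ¬ E a b)
    × (∀ a b → a ∈ V2 → b ∈ V2 → ¬ E a b)

  IsBiBlock : Set
  IsBiBlock = Connected AllV
            × (∀ B → IsBlock B → ∃₂ λ V1 V2 → IsBipartition B V1 V2)

  InClassB : Set
  InClassB = IsBiBlock
           × (∃₂ λ B₁ B₂ → IsBlock B₁ × IsBlock B₂ × ∃ λ v → v ∈ B₁ × v ∉ B₂)
           × (∀ B → IsBlock B → AtMostTwo (λ v → v ∈ B × IsCut v))

  IsMinNC : Subset n → Fin n → Set
  IsMinNC V u = u ∈ V × ¬ IsCut u × (∀ w → w ∈ V → ¬ IsCut w → u ≤ᶠ w)

  IsK11 : Subset n → Subset n → Set
  IsK11 V1 V2 = ExactlyOne (_∈ V1) × ExactlyOne (_∈ V2)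

  IsLeaf : Subset n → Set
  IsLeaf B = ExactlyOne (λ v → v ∈ B × IsCut v)

  InNC : Subset n → Subset n → Subset n → Fin n → Set
  InNC B V1 V2 v =
      (IsK11 V1 V2 × (IsMinNC V1 v ⊎ IsMinNC V2 v))
    ⊎ (¬ IsK11 V1 V2 × ExactlyTwo (λ w → w ∈ V1 × IsCut w) × IsMinNC V2 v)
    ⊎ (¬ IsK11 V1 V2 × ExactlyTwo (λ w → w ∈ V2 × IsCut w) × IsMinNC V1 v)
    ⊎ (¬ IsK11 V1 V2 × IsLeaf B × (IsMinNC V1 v ⊎ IsMinNC V2 v))

  InT : VPred n
  InT v = IsCut v
        ⊎ (∃ λ B → ∃₂ λ V1 V2 → IsBlock B × IsBipartition B V1 V2 × InNC B V1 V2 v)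

  IsDiam : VPred n → ℕ → Set
  IsDiam S D =
      (∀ u v → S u → S v → ∃ λ k → k ≤ D × Walk S u v k)
    × (∃₂ λ u v → S u × S v × (∀ k → k < D → ¬ Walk S u v k))

{-# OPTIONS --safe #-}
module Submission where

-- Any walk of G between vertices of T can be rerouted inside T without getting longer. A
-- non-cut vertex x of a block B = K(X, P), x ∈ X, has all its neighbours in P; X contains a
-- vertex of T (a cut vertex, or else its least non-cut vertex, which lies in NC_B), adjacent
-- to the same vertices of P. So a non-cut vertex of the walk can be replaced by a vertex of
-- T, and two consecutive non-cut vertices can be skipped. Conversely, for all a and b some
-- t ∈ T satisfies d(a, b) ≤ d(t, b): either a twin of a in T, or a vertex of T beyond a cut
-- vertex c of a's block, so that every walk from t to b passes through c. Applied twice to a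
-- diametral pair of G this yields two vertices of T at distance at least diam(G).

open import Defs
open import Data.Nat as ℕ using (ℕ; zero; suc; _+_; _∸_; _≤_; _<_; _≤?_; z≤n; s≤s)
open import Data.Nat.Induction using (<-rec)
open import Data.Nat.Properties
  using (+-comm; +-monoˡ-<; +-mono-≤; +-monoˡ-≤; anyUpTo?; m+[n∸m]≡n; m≤n+m; m≤n⇒m≤1+n; n≤1+n;
         <-≤-trans; ≤-pred; ≤-refl; ≤-trans; ≰⇒>; ≮⇒≥; <⇒≱; module ≤-Reasoning)
open import Data.Fin as Fin using (Fin; toℕ)
import Data.Fin.Properties as Fin
open import Data.Fin.Subset using (Subset; _∈_; _∉_; _⊆_; _⊃_; _∪_)
open import Data.Fin.Subset.Properties
  using (_∈?_; _⊂?_; anySubset?; x∈p∪q⁺; x∈p∪q⁻)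
open import Data.Fin.Subset.Induction using (Acc; acc; ⊃-wellFounded)
open import Data.Vec using (tabulate)
open import Data.Vec.Properties using ([]=⇒lookup; lookup⇒[]=; lookup∘tabulate)
open import Data.Product using (∃; ∃₂; _×_; _,_; proj₁; proj₂)
open import Data.Sum using (_⊎_; inj₁; inj₂; [_,_]′) renaming (swap to ⊎-swap)
open import Data.Unit using (⊤; tt)
open import Data.Empty using (⊥-elim)
open import Function using (_∘_; _∘₂_; id)
open import Relation.Nullary using (Dec; yes; no; ¬_; does)
open import Relation.Nullary.Decidable
  using (_×-dec_; _⊎-dec_; _→-dec_; ¬?; dec-true; decidable-stable)
open import Relation.Unary using (Decidable)
open import Relation.Binary.PropositionalEquality using (_≡_; _≢_; refl; sym; trans; subst)

Least : (ℕ → Set) → ℕ → Set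
Least P m = P m × (∀ {j} → j < m → ¬ P j)

least : ∀ {P : ℕ → Set} → Decidable P → ∀ {k} → P k → ∃ (Least P)
least {P} P? {k} = <-rec (λ k → P k → ∃ (Least P)) go k
  where
  go : ∀ k → (∀ {j} → j < k → P j → ∃ (Least P)) → P k → ∃ (Least P)
  go k rec pk with anyUpTo? P? k
  ... | yes (j , j<k , pj) = rec j<k pj
  ... | no none = k , pk , λ j<k pj → none (_ , j<k , pj)

module Walks {n : ℕ} (G : Graph n) where
  open Graph G

  Reach : VPred n → Fin n → Fin n → Set
  Reach S u v = ∃ λ k → Walk G S u v k

  source : ∀ {S u v k} → Walk G S u v k → S u
  source (here s)     = s
  source (step s _ _) = s

  target : ∀ {S u v k} → Walk G S u v k → S v
  target (here s)     = s
  target (step _ _ w) = target w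

  infixr 5 _++_
  _++_ : ∀ {S u w v k l} → Walk G S u w k → Walk G S w v l → Walk G S u v (k + l)
  here _       ++ q = q
  step s e p ++ q = step s e (p ++ q)

  edge : ∀ {S u v} → S u → S v → E u v → Walk G S u v 1
  edge su sv e = step su e (here sv)

  reverse : ∀ {S u v k} → Walk G S u v k → Walk G S v u k
  reverse (here s) = here s
  reverse {k = suc k} (step s e p) =
    subst (Walk G _ _ _) (+-comm k 1) (reverse p ++ edge (source p) s (E-sym e))

  weaken : ∀ {S S′ : VPred n} → (∀ {x} → S x → S′ x) →
           ∀ {u v k} → Walk G S u v k → Walk G S′ u v k
  weaken f (here s)     = here (f s)
  weaken f (step s e p) = step (f s) e (weaken f p)

  Reach-trans : ∀ {S a b c} → Reach S a b → Reach S b c → Reach S a c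
  Reach-trans (k , p) (l , q) = k + l , p ++ q

  Reach-sym : ∀ {S a b} → Reach S a b → Reach S b a
  Reach-sym (k , p) = k , reverse p

  connected-via : ∀ (S : VPred n) z → S z → (∀ y → S y → Reach S y z) → Connected G S
  connected-via S z sz to-z u v su sv = Reach-trans (to-z u su) (Reach-sym (to-z v sv))

  E⇒≢ : ∀ {a b} → E a b → a ≢ b
  E⇒≢ e refl = E-irr e

  Walk≤ : VPred n → Fin n → Fin n → ℕ → Set
  Walk≤ S u v k = ∃ λ j → j ≤ k × Walk G S u v j

  Walk≤-step : ∀ {S u x v k} → S u → E u x → Walk≤ S x v k → Walk≤ S u v (suc k)
  Walk≤-step su e (j , j≤k , w) = suc j , s≤s j≤k , step su e w

  Walk≤-weaken : ∀ {S u v k l} → k ≤ l → Walk≤ S u v k → Walk≤ S u v l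
  Walk≤-weaken k≤l (j , j≤k , w) = j , ≤-trans j≤k k≤l , w

  crossing-edge : ∀ {Q : VPred n} → Decidable Q → ∀ {S u v k} → Walk G S u v k → Q u → ¬ Q v →
                  ∃₂ λ y z → Q y × ¬ Q z × E y z
  crossing-edge Q? (here _) Qu ¬Qv = ⊥-elim (¬Qv Qu)
  crossing-edge Q? (step {w = x} _ e p) Qu ¬Qv with Q? x
  ... | yes Qx = crossing-edge Q? p Qx ¬Qv
  ... | no ¬Qx = _ , _ , Qu , ¬Qx , e

  last-edge : ∀ {w f k} → Walk G (AllV G) w f k → w ≢ f → ∃ λ y → Reach (_≢ f) w y × E y f
  last-edge (here _) w≢f = ⊥-elim (w≢f refl)
  last-edge {w} {f} (step {w = w′} _ e p) w≢f with w′ Fin.≟ f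
  ... | yes refl = w , (0 , here w≢f) , e
  ... | no w′≢f  = let (y , (j , r) , e′) = last-edge p w′≢f in y , (suc j , step w≢f e r) , e′

  vertexAt : ∀ {S u v k} → Walk G S u v k → Fin (suc k) → Fin n
  vertexAt {u = u} _ Fin.zero    = u
  vertexAt (step _ _ w) (Fin.suc i) = vertexAt w i

  take : ∀ {S u v k} (w : Walk G S u v k) (i : Fin (suc k)) →
         Walk G S u (vertexAt w i) (toℕ i)
  take w            Fin.zero    = here (source w)
  take (step s e w) (Fin.suc i) = step s e (take w i)

  drop : ∀ {S u v k} (w : Walk G S u v k) (i : Fin (suc k)) →
         Walk G S (vertexAt w i) v (k ∸ toℕ i)
  drop w            Fin.zero    = w
  drop (step _ _ w) (Fin.suc i) = drop w i

  -- A walk visiting more than n vertices repeats one; cut out the closed part.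
  shorten : ∀ {S u v k} → Walk G S u v k → n ≤ k → ∃ λ k′ → k′ < k × Walk G S u v k′
  shorten {S} {u} {v} {k} w n≤k with Fin.pigeonhole (s≤s n≤k) (vertexAt w)
  ... | i , j , i<j , wᵢ≡wⱼ =
    toℕ i + (k ∸ toℕ j) , shorter ,
    take w i ++ subst (λ z → Walk G S z v (k ∸ toℕ j)) (sym wᵢ≡wⱼ) (drop w j)
    where
    shorter : toℕ i + (k ∸ toℕ j) < k
    shorter = subst (toℕ i + (k ∸ toℕ j) <_) (m+[n∸m]≡n (≤-pred (Fin.toℕ<n j)))
                    (+-monoˡ-< (k ∸ toℕ j) i<j)

  shorten-below-n : ∀ {S u v k} → Walk G S u v k → ∃ λ k′ → k′ < n × Walk G S u v k′
  shorten-below-n {S} {u} {v} {k} = <-rec (λ k → Walk G S u v k → Goal) go k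
    where
    Goal : Set
    Goal = ∃ λ k′ → k′ < n × Walk G S u v k′
    go : ∀ k → (∀ {j} → j < k → Walk G S u v j → Goal) → Walk G S u v k → Goal
    go k rec w with n ≤? k
    ... | no n≰k = k , ≰⇒> n≰k , w
    ... | yes n≤k with shorten w n≤k
    ...   | k′ , k′<k , w′ = rec k′<k w′

  walk? : ∀ {S} → Decidable S → ∀ u v k → Dec (Walk G S u v k)
  walk? S? u v zero with S? u | u Fin.≟ v
  ... | yes su | yes refl = yes (here su)
  ... | no ¬su | _        = no λ { (here s) → ¬su s }
  ... | yes _  | no u≢v   = no λ { (here _) → u≢v refl }
  walk? S? u v (suc k) with S? u | Fin.any? (λ w → E? u w ×-dec walk? S? w v k)
  ... | yes su | yes (w , e , p) = yes (step su e p)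
  ... | no ¬su | _               = no λ { (step s _ _) → ¬su s }
  ... | yes _  | no none         = no λ { (step _ e p) → none (_ , e , p) }

  reach? : ∀ {S} → Decidable S → ∀ u v → Dec (Reach S u v)
  reach? S? u v with anyUpTo? (walk? S? u v) n
  ... | yes (k , _ , w) = yes (k , w)
  ... | no none = no λ (_ , w) → let (k , k<n , w′) = shorten-below-n w in none (k , k<n , w′)

  connected? : ∀ {S} → Decidable S → Dec (Connected G S)
  connected? S? = Fin.all? λ u → Fin.all? λ v → S? u →-dec (S? v →-dec reach? S? u v)

  _≢?_ : ∀ (x v : Fin n) → Dec (x ≢ v)
  x ≢? v = ¬? (x Fin.≟ v)

  isCut? : Decidable (IsCut G)
  isCut? v = ¬? (connected? (_≢? v))

  ¬cut⇒connected : ∀ {v} → ¬ IsCut G v → Connected G (_≢ v)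
  ¬cut⇒connected {v} = decidable-stable (connected? (_≢? v))

  shortest : ∀ {S} → Decidable S → ∀ {u v k} → Walk G S u v k → ∃ (Least (Walk G S u v))
  shortest S? {u} {v} = least (walk? S? u v)

  Separates : Fin n → Fin n → Fin n → Set
  Separates c a b = ¬ Reach (_≢ c) a b

  Separates-sym : ∀ {c a b} → Separates c a b → Separates c b a
  Separates-sym sep = sep ∘ Reach-sym

  separated-vertex : ∀ {c a} → IsCut G c → a ≢ c → ∃ λ w → w ≢ c × Separates c a w
  separated-vertex {c} {a} cut a≢c with Fin.any? (λ w → (w ≢? c) ×-dec ¬? (reach? (_≢? c) a w))
  ... | yes found = found
  ... | no none = ⊥-elim (cut (connected-via _ a a≢c to-a))
    where
    to-a : ∀ y → y ≢ c → Reach (_≢ c) y a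
    to-a y y≢c with reach? (_≢? c) a y
    ... | yes a↝y = Reach-sym a↝y
    ... | no ¬a↝y = ⊥-elim (none (y , y≢c , ¬a↝y))

  -- The part of the walk before its first visit to f avoids c, as c lies beyond f.
  walk-to-separator : ∀ {t f c k} → c ≢ f → Separates f t c → Walk G (AllV G) t f k →
                      Reach (_≢ c) t f
  walk-to-separator c≢f _ (here _) = 0 , here (c≢f ∘ sym)
  walk-to-separator {t} {f} {c} c≢f sep (step {w = t′} _ e p) with t Fin.≟ f
  ... | yes refl = 0 , here (c≢f ∘ sym)
  ... | no t≢f   =
    let (j , r) = walk-to-separator c≢f (λ (j , r) → sep (suc j , step t≢f e r)) p in
    suc j , step t≢c e r
    where
    t≢c : t ≢ c
    t≢c refl = sep (0 , here t≢f)

  data OnWalk {S : VPred n} (y : Fin n) : ∀ {u v k} → Walk G S u v k → Set where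
    first : ∀ {u v k} {w : Walk G S u v k} → y ≡ u → OnWalk y w
    later : ∀ {u x v k} {s : S u} {e : E u x} {p : Walk G S x v k} →
            OnWalk y p → OnWalk y (step s e p)

  onWalk? : ∀ {S u v k} y (w : Walk G S u v k) → Dec (OnWalk y w)
  onWalk? {u = u} y w with y Fin.≟ u
  ... | yes y≡u = yes (first y≡u)
  onWalk? y (here _)     | no y≢u = no λ { (first y≡u) → y≢u y≡u }
  onWalk? y (step _ _ p) | no y≢u with onWalk? y p
  ... | yes on = yes (later on)
  ... | no off = no λ { (first y≡u) → y≢u y≡u ; (later on) → off on }

  OnWalk⇒S : ∀ {S u v k y} {w : Walk G S u v k} → OnWalk y w → S y
  OnWalk⇒S {w = w} (first refl) = source w
  OnWalk⇒S (later on)           = OnWalk⇒S on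

  OnWalk-end : ∀ {S u v k} (w : Walk G S u v k) → OnWalk v w
  OnWalk-end (here _)     = first refl
  OnWalk-end (step _ _ p) = later (OnWalk-end p)

  walk-along : ∀ {S u v k} (w : Walk G S u v k) → Walk G (λ y → OnWalk y w) u v k
  walk-along (here _)     = here (first refl)
  walk-along (step _ e p) = step (first refl) e (weaken later (walk-along p))

  suffix : ∀ {S u v k y} {w : Walk G S u v k} → OnWalk y w →
           ∃ λ j → j ≤ k × Walk G (λ z → OnWalk z w) y v j
  suffix {k = k} {w = w} (first refl) = k , ≤-refl , walk-along w
  suffix (later on) =
    let (j , j≤k , q) = suffix on in j , m≤n⇒m≤1+n j≤k , weaken later q

  Simple : ∀ {S u v k} → Walk G S u v k → Set
  Simple (here _)         = ⊤
  Simple (step {u} _ _ p) = ¬ OnWalk u p × Simple p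

  shortest⇒simple : ∀ {S u v k} (w : Walk G S u v k) →
                    (∀ {j} → j < k → ¬ Walk G S u v j) → Simple w
  shortest⇒simple (here _) _ = tt
  shortest⇒simple (step s e p) minimal =
    (λ on → let (j , j≤k , q) = suffix on in minimal (s≤s j≤k) (weaken OnWalk⇒S q)) ,
    shortest⇒simple p (λ j<k q → minimal (s≤s j<k) (step s e q))

  simple-avoid : ∀ {S p q k} (w : Walk G S p q k) → Simple w → ∀ {v a} →
                 OnWalk v w → OnWalk a w → a ≢ v →
                 Reach (λ y → OnWalk y w × y ≢ v) a p ⊎ Reach (λ y → OnWalk y w × y ≢ v) a q
  simple-avoid (here _) _ (first refl) (first refl) a≢v = ⊥-elim (a≢v refl)
  simple-avoid (step _ _ _) _ _ (first refl) a≢v = inj₁ (0 , here (first refl , a≢v))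
  simple-avoid (step _ _ p) (p∌u , _) (first refl) (later on) a≢v =
    let (j , _ , r) = suffix on in
    inj₂ (j , weaken (λ m → later m , λ { refl → p∌u m }) r)
  simple-avoid (step _ e p) (p∌u , simple) (later v-on) (later a-on) a≢v
    with simple-avoid p simple v-on a-on a≢v
  ... | inj₂ (j , r) = inj₂ (j , weaken (λ (m , ne) → later m , ne) r)
  ... | inj₁ (j , r) =
    inj₁ (j + 1 , (weaken (λ (m , ne) → later m , ne) r ++
                   edge (later (proj₁ (target r)) , proj₂ (target r))
                        (first refl , λ { refl → p∌u v-on }) (E-sym e)))

toSubset : ∀ {m} {P : Fin m → Set} → Decidable P → Subset m
toSubset P? = tabulate (does ∘ P?)

∈toSubset⁺ : ∀ {m} {P : Fin m → Set} (P? : Decidable P) {x} → P x → x ∈ toSubset P?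
∈toSubset⁺ P? {x} px = lookup⇒[]= x _ (trans (lookup∘tabulate _ x) (dec-true (P? x) px))

∈toSubset⁻ : ∀ {m} {P : Fin m → Set} (P? : Decidable P) {x} → x ∈ toSubset P? → P x
∈toSubset⁻ P? {x} x∈ with P? x | trans (sym (lookup∘tabulate (does ∘ P?) x)) ([]=⇒lookup x∈)
... | yes px | _ = px
... | no _   | ()

module Blocks {n : ℕ} (G : Graph n) where
  open Graph G
  open Walks G

  blockLike? : Decidable (BlockLike G)
  blockLike? B = Fin.any? (_∈? B) ×-dec (connected? (_∈? B) ×-dec
    Fin.all? λ v → (v ∈? B) →-dec connected? (λ w → (w ∈? B) ×-dec (w ≢? v)))

  block-containing : ∀ S → BlockLike G S → ∃ λ B → S ⊆ B × IsBlock G B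
  block-containing S = go S (⊃-wellFounded S)
    where
    go : ∀ S → Acc _⊃_ S → BlockLike G S → ∃ λ B → S ⊆ B × IsBlock G B
    go S (acc larger) bl with anySubset? (λ B′ → (S ⊂? B′) ×-dec blockLike? B′)
    ... | yes (B′ , S⊂B′ , bl′) =
      let (B , B′⊆B , block) = go B′ (larger S⊂B′) bl′ in B , B′⊆B ∘ proj₁ S⊂B′ , block
    ... | no none = S , id , bl , maximal
      where
      maximal : ∀ B′ → S ⊆ B′ → BlockLike G B′ → B′ ⊆ S
      maximal B′ S⊆B′ bl′ {x} x∈B′ with x ∈? S
      ... | yes x∈S = x∈S
      ... | no x∉S = ⊥-elim (none (B′ , (S⊆B′ , x , x∈B′ , x∉S) , bl′))

  blockLike-avoid : ∀ {B} → BlockLike G B → ∀ v {y z} → y ∈ B → y ≢ v → z ∈ B → z ≢ v →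
                    Reach (λ w → w ∈ B × w ≢ v) y z
  blockLike-avoid {B} (_ , connected , robust) v {y} {z} y∈B y≢v z∈B z≢v with v ∈? B
  ... | yes v∈B = robust v v∈B y z (y∈B , y≢v) (z∈B , z≢v)
  ... | no v∉B  = let (k , w) = connected y z y∈B z∈B in
                  k , weaken (λ x∈B → x∈B , λ { refl → v∉B x∈B }) w

  block-avoid : ∀ {B} → IsBlock G B → ∀ v {y z} → y ∈ B → y ≢ v → z ∈ B → z ≢ v → Reach (_≢ v) y z
  block-avoid (blockLike , _) v y∈B y≢v z∈B z≢v =
    let (k , r) = blockLike-avoid blockLike v y∈B y≢v z∈B z≢v in k , weaken proj₂ r

  -- Two blocks sharing two vertices have a block-like union, so maximality merges them.
  two-common⇒⊆ : ∀ {B₁ B₂ a b} → IsBlock G B₁ → IsBlock G B₂ → a ∈ B₁ → a ∈ B₂ →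
                  b ∈ B₁ → b ∈ B₂ → a ≢ b → B₂ ⊆ B₁
  two-common⇒⊆ {B₁} {B₂} {a} {b} (bl₁@(_ , conn₁ , _) , maximal₁) (bl₂@(_ , conn₂ , _) , _)
               a∈₁ a∈₂ b∈₁ b∈₂ a≢b =
    maximal₁ U inj-U₁ blockLike-U ∘ inj-U₂
    where
    U = B₁ ∪ B₂
    inj-U₁ : B₁ ⊆ U
    inj-U₁ = x∈p∪q⁺ ∘ inj₁
    inj-U₂ : B₂ ⊆ U
    inj-U₂ = x∈p∪q⁺ ∘ inj₂
    common-avoiding : ∀ v → ∃ λ z → z ∈ B₁ × z ∈ B₂ × z ≢ v
    common-avoiding v with a Fin.≟ v
    ... | yes refl = b , b∈₁ , b∈₂ , a≢b ∘ sym
    ... | no a≢v   = a , a∈₁ , a∈₂ , a≢v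
    avoid-U : ∀ v {y z} → y ∈ U → y ≢ v → z ∈ B₁ → z ∈ B₂ → z ≢ v →
              Reach (λ w → w ∈ U × w ≢ v) y z
    avoid-U v {y} y∈U y≢v z∈₁ z∈₂ z≢v with x∈p∪q⁻ B₁ B₂ y∈U
    ... | inj₁ y∈₁ = let (k , w) = blockLike-avoid bl₁ v y∈₁ y≢v z∈₁ z≢v in
                     k , weaken (λ (m , ne) → inj-U₁ m , ne) w
    ... | inj₂ y∈₂ = let (k , w) = blockLike-avoid bl₂ v y∈₂ y≢v z∈₂ z≢v in
                     k , weaken (λ (m , ne) → inj-U₂ m , ne) w
    robust : ∀ v → v ∈ U → Connected G (λ w → w ∈ U × w ≢ v)
    robust v _ =
      let (z , z∈₁ , z∈₂ , z≢v) = common-avoiding v in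
      connected-via _ z (inj-U₁ z∈₁ , z≢v) λ y (y∈U , y≢v) → avoid-U v y∈U y≢v z∈₁ z∈₂ z≢v
    to-a : ∀ y → y ∈ U → Reach (_∈ U) y a
    to-a y y∈U with x∈p∪q⁻ B₁ B₂ y∈U
    ... | inj₁ y∈₁ = let (k , w) = conn₁ y a y∈₁ a∈₁ in k , weaken inj-U₁ w
    ... | inj₂ y∈₂ = let (k , w) = conn₂ y a y∈₂ a∈₂ in k , weaken inj-U₂ w
    blockLike-U : BlockLike G U
    blockLike-U = (a , inj-U₁ a∈₁) , connected-via _ a (inj-U₁ a∈₁) to-a , robust

  -- x together with a shortest p–q path avoiding x is a cycle (or an edge), hence block-like.
  cycle⇒block : ∀ {x p q k} → E x p → E x q → Walk G (_≢ x) p q k →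
                ∃ λ B → IsBlock G B × x ∈ B × p ∈ B × q ∈ B
  cycle⇒block {x} {p} {q} x-p x-q W₀ with shortest (_≢? x) W₀
  ... | _ , W , minimal =
    let (B , C⊆B , block) = block-containing C blockLike in
    B , block , C⊆B x∈C , C⊆B p∈C , C⊆B q∈C
    where
    InC : Fin n → Set
    InC y = y ≡ x ⊎ OnWalk y W
    InC? : Decidable InC
    InC? y = (y Fin.≟ x) ⊎-dec onWalk? y W
    C = toSubset InC?
    on⇒∈C : ∀ {y} → OnWalk y W → y ∈ C
    on⇒∈C = ∈toSubset⁺ InC? ∘ inj₂
    x∈C : x ∈ C
    x∈C = ∈toSubset⁺ InC? (inj₁ refl)
    p∈C : p ∈ C
    p∈C = on⇒∈C (first refl)
    q∈C : q ∈ C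
    q∈C = on⇒∈C (OnWalk-end W)
    to-q : ∀ y → y ∈ C × y ≢ x → Reach (λ w → w ∈ C × w ≢ x) y q
    to-q y (y∈C , y≢x) with ∈toSubset⁻ InC? y∈C
    ... | inj₁ y≡x = ⊥-elim (y≢x y≡x)
    ... | inj₂ y-on = let (j , _ , r) = suffix y-on in j , weaken (λ m → on⇒∈C m , OnWalk⇒S m) r
    robust : ∀ v → v ∈ C → Connected G (λ w → w ∈ C × w ≢ v)
    robust v v∈C with ∈toSubset⁻ InC? v∈C
    ... | inj₁ refl = connected-via _ q (q∈C , OnWalk⇒S (OnWalk-end W)) to-q
    ... | inj₂ v-on = connected-via _ x (x∈C , λ x≡v → OnWalk⇒S v-on (sym x≡v)) to-x-avoiding
      where
      v≢x : v ≢ x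
      v≢x = OnWalk⇒S v-on
      lift : ∀ {a b k} → Walk G (λ y → OnWalk y W × y ≢ v) a b k →
             Walk G (λ w → w ∈ C × w ≢ v) a b k
      lift = weaken (λ (m , ne) → on⇒∈C m , ne)
      close : ∀ {y e} → E e x → Reach (λ y → OnWalk y W × y ≢ v) y e →
              Reach (λ w → w ∈ C × w ≢ v) y x
      close e-x (j , r) = j + 1 , (lift r ++ edge (target (lift r)) (x∈C , v≢x ∘ sym) e-x)
      to-x-avoiding : ∀ y → y ∈ C × y ≢ v → Reach (λ w → w ∈ C × w ≢ v) y x
      to-x-avoiding y (y∈C , y≢v) with ∈toSubset⁻ InC? y∈C
      ... | inj₁ refl = 0 , here (x∈C , y≢v)
      ... | inj₂ y-on with simple-avoid W (shortest⇒simple W minimal) v-on y-on y≢v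
      ...   | inj₁ r = close (E-sym x-p) r
      ...   | inj₂ r = close (E-sym x-q) r
    to-x : ∀ y → y ∈ C → Reach (_∈ C) y x
    to-x y y∈C with ∈toSubset⁻ InC? y∈C
    ... | inj₁ refl = 0 , here x∈C
    ... | inj₂ y-on = let (j , _ , r) = suffix y-on in
                      j + 1 , (weaken on⇒∈C r ++ edge q∈C x∈C (E-sym x-q))
    blockLike : BlockLike G C
    blockLike = (x , x∈C) , connected-via _ x x∈C to-x , robust

  edge⇒block : ∀ {u v} → E u v → ∃ λ B → IsBlock G B × u ∈ B × v ∈ B
  edge⇒block u-v =
    let (B , block , u∈B , v∈B , _) = cycle⇒block u-v u-v (here (E⇒≢ u-v ∘ sym)) in
    B , block , u∈B , v∈B

module Bipartition {n : ℕ} (G : Graph n) where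
  open Graph G

  record Sides (B X P : Subset n) : Set where
    field
      covers        : ∀ v → v ∈ B → v ∈ X ⊎ v ∈ P
      X⊆B           : ∀ v → v ∈ X → v ∈ B
      P⊆B           : ∀ v → v ∈ P → v ∈ B
      disjoint      : ∀ v → v ∈ X → v ∉ P
      P-inhabited   : ∃ (_∈ P)
      complete      : ∀ a b → a ∈ X → b ∈ P → E a b
      X-independent : ∀ a b → a ∈ X → b ∈ X → ¬ E a b
      P-independent : ∀ a b → a ∈ P → b ∈ P → ¬ E a b

    complete′ : ∀ a b → a ∈ P → b ∈ X → E a b
    complete′ a b a∈P b∈X = E-sym (complete b a b∈X a∈P)

    X-edge⇒P : ∀ a b → a ∈ X → b ∈ B → E a b → b ∈ P
    X-edge⇒P a b a∈X b∈B e with covers b b∈B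
    ... | inj₁ b∈X = ⊥-elim (X-independent a b a∈X b∈X e)
    ... | inj₂ b∈P = b∈P

    P-edge⇒X : ∀ a b → a ∈ P → b ∈ B → E a b → b ∈ X
    P-edge⇒X a b a∈P b∈B e with covers b b∈B
    ... | inj₁ b∈X = b∈X
    ... | inj₂ b∈P = ⊥-elim (P-independent a b a∈P b∈P e)

    X≢P : ∀ {a b} → a ∈ X → b ∈ P → a ≢ b
    X≢P {a} a∈X b∈P refl = disjoint a a∈X b∈P

  sides : ∀ {B X P} → IsBipartition G B X P → Sides B X P
  sides (cov , X⊆B , P⊆B , dj , _ , neP , cp , iX , iP) =
    record { covers = cov ; X⊆B = X⊆B ; P⊆B = P⊆B ; disjoint = dj
           ; P-inhabited = neP
           ; complete = cp ; X-independent = iX ; P-independent = iP }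

  swap : ∀ {B X P} → IsBipartition G B X P → IsBipartition G B P X
  swap (cov , X⊆B , P⊆B , dj , neX , neP , cp , iX , iP) =
    ⊎-swap ∘₂ cov , P⊆B , X⊆B , (λ v v∈P v∈X → dj v v∈X v∈P) , neP , neX ,
    (λ a b a∈P b∈X → E-sym (cp b a b∈X a∈P)) , iP , iX

module Distance {n : ℕ} (G : Graph n) (connected : Connected G (AllV G)) where
  open Graph G
  open Walks G

  private
    geodesic : ∀ u v → ∃ (Least (Walk G (AllV G) u v))
    geodesic u v = shortest (λ _ → yes tt) (proj₂ (connected u v tt tt))

  dist : Fin n → Fin n → ℕ
  dist u v = proj₁ (geodesic u v)

  dist-walk : ∀ u v → Walk G (AllV G) u v (dist u v)
  dist-walk u v = proj₁ (proj₂ (geodesic u v))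

  dist-shortest : ∀ {u v j} → j < dist u v → ¬ Walk G (AllV G) u v j
  dist-shortest {u} {v} = proj₂ (proj₂ (geodesic u v))

  dist-minimal : ∀ {S u v k} → Walk G S u v k → dist u v ≤ k
  dist-minimal w = ≮⇒≥ λ k<d → dist-shortest k<d (weaken (λ _ → tt) w)

  dist-sym : ∀ u v → dist v u ≤ dist u v
  dist-sym u v = dist-minimal (reverse (dist-walk u v))

  dist-triangle : ∀ u v w → dist u w ≤ dist u v + dist v w
  dist-triangle u v w = dist-minimal (dist-walk u v ++ dist-walk v w)

  1≤dist : ∀ {u v} → u ≢ v → 1 ≤ dist u v
  1≤dist {u} {v} u≢v with dist u v | dist-walk u v
  ... | zero  | here _ = ⊥-elim (u≢v refl)
  ... | suc _ | _      = s≤s z≤n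

  2≤dist : ∀ {u v} → u ≢ v → ¬ E u v → 2 ≤ dist u v
  2≤dist {u} {v} u≢v ¬u-v with dist u v | dist-walk u v
  ... | zero        | here _                = ⊥-elim (u≢v refl)
  ... | suc zero    | step _ u-v (here _) = ⊥-elim (¬u-v u-v)
  ... | suc (suc _) | _                     = s≤s (s≤s z≤n)

  separator-walk : ∀ {c a b k} → a ≢ c → Separates c a b → Walk G (AllV G) a b k →
                   dist a c + dist c b ≤ k
  separator-walk a≢c sep (here _) = ⊥-elim (sep (0 , here a≢c))
  separator-walk {c} {a} {b} a≢c sep (step {w = a′} _ a-a′ p) with a′ Fin.≟ c
  ... | yes refl = +-mono-≤ (dist-minimal (edge tt tt a-a′)) (dist-minimal p)
  ... | no a′≢c  =
    ≤-trans (+-mono-≤ (dist-minimal (step tt a-a′ (dist-walk a′ c))) (≤-refl {dist c b}))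
            (s≤s (separator-walk a′≢c (λ (j , r) → sep (suc j , step a≢c a-a′ r)) p))

  separator-dist : ∀ {c a b} → a ≢ c → Separates c a b → dist a c + dist c b ≤ dist a b
  separator-dist a≢c sep = separator-walk a≢c sep (dist-walk _ _)

  geodesic-first-step : ∀ {c b} → c ≢ b →
                        ∃₂ λ w k → E c w × Walk G (_≢ c) w b k × suc k ≡ dist c b
  geodesic-first-step {c} {b} c≢b with dist c b | dist-walk c b | dist-shortest {c} {b}
  ... | _ | here _ | _ = ⊥-elim (c≢b refl)
  ... | _ | step _ e p | minimal with shortest⇒simple (step tt e p) minimal
  ...   | c∉p , _ = _ , _ , e , weaken (λ on → λ { refl → c∉p on }) (walk-along p) , refl

  twin-dist : ∀ {u a b} → (∀ z → E u z → E a z) → u ≢ b → dist a b ≤ dist u b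
  twin-dist {u} {a} {b} N[u]⊆N[a] u≢b with dist u b | dist-walk u b
  ... | _ | here _       = ⊥-elim (u≢b refl)
  ... | _ | step _ e p   = dist-minimal (step tt (N[u]⊆N[a] _ e) p)

module ClassB {n : ℕ} (G : Graph n)
  (connected : Connected G (AllV G))
  (bipartite : ∀ B → IsBlock G B → ∃₂ λ X P → IsBipartition G B X P)
  (two-blocks : ∃₂ λ B₁ B₂ → IsBlock G B₁ × IsBlock G B₂ × ∃ λ v → v ∈ B₁ × v ∉ B₂)
  (at-most-two-cuts : ∀ B → IsBlock G B → AtMostTwo (λ v → v ∈ B × IsCut G v))
  where
  open Graph G
  open Walks G
  open Blocks G
  open Bipartition G
  open Distance G connected

  orient : ∀ {B} → IsBlock G B → ∀ {x} → x ∈ B → ∃₂ λ X P → IsBipartition G B X P × x ∈ X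
  orient {B} block {x} x∈B with bipartite B block
  ... | X , P , bp with Sides.covers (sides bp) x x∈B
  ...   | inj₁ x∈X = X , P , bp , x∈X
  ...   | inj₂ x∈P = P , X , swap bp , x∈P

  ¬cut⇒neighbour∈block : ∀ {B} → IsBlock G B → ∀ {y z} → y ∈ B → ¬ IsCut G y → E y z → z ∈ B
  ¬cut⇒neighbour∈block {B} block {y} {z} y∈B ¬cut y-z with orient block y∈B
  ... | X , P , bp , y∈X =
    let (B′ , block′ , y∈B′ , q∈B′ , z∈B′) = cycle⇒block y-q y-z (proj₂ q↝z) in
    two-common⇒⊆ block block′ y∈B y∈B′ (P⊆B q q∈P) q∈B′ (X≢P y∈X q∈P) z∈B′
    where
    open Sides (sides bp)
    q = proj₁ P-inhabited
    q∈P = proj₂ P-inhabited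
    y-q = complete y q y∈X q∈P
    q↝z : Reach (_≢ y) q z
    q↝z = ¬cut⇒connected ¬cut q z (λ { refl → E-irr y-q }) (λ { refl → E-irr y-z })

  CutIn : Subset n → VPred n
  CutIn B v = v ∈ B × IsCut G v

  -- The second block would lie inside a block containing every vertex, against its maximality.
  block≠everything : ∀ {B} → IsBlock G B → ¬ (∀ x → x ∈ B)
  block≠everything {B} (blockLike , _) everything =
    let (_ , B₂ , _ , (_ , maximal₂) , v , _ , v∉B₂) = two-blocks in
    v∉B₂ (maximal₂ B (λ {x} _ → everything x) blockLike (everything v))

  block-has-cut : ∀ {B} → IsBlock G B → ∃ (CutIn B)
  block-has-cut {B} block@(((b , b∈B) , _) , _)
    with Fin.¬∀⟶∃¬ n (_∈ B) (_∈? B) (block≠everything block)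
  ... | w , w∉B with crossing-edge (_∈? B) (proj₂ (connected b w tt tt)) b∈B w∉B
  ...   | y , z , y∈B , z∉B , y-z with isCut? y
  ...     | yes cut = y , y∈B , cut
  ...     | no ¬cut = ⊥-elim (z∉B (¬cut⇒neighbour∈block block y∈B ¬cut y-z))

  cutIn? : ∀ B → Decidable (CutIn B)
  cutIn? B v = (v ∈? B) ×-dec isCut? v

  only-first : ∀ {B a b} → (∀ w → CutIn B w → w ≡ a ⊎ w ≡ b) → ¬ CutIn B b →
               ∀ w → CutIn B w → w ≡ a
  only-first among ¬b-cut w w-cut with among w w-cut
  ... | inj₁ w≡a  = w≡a
  ... | inj₂ refl = ⊥-elim (¬b-cut w-cut)

  two-cuts-or-leaf : ∀ {B} → IsBlock G B → ExactlyTwo (CutIn B) ⊎ IsLeaf G B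
  two-cuts-or-leaf {B} block with at-most-two-cuts B block | block-has-cut block
  ... | a , b , among | c , c-cut with cutIn? B a | cutIn? B b | a Fin.≟ b
  ...   | yes a-cut | yes b-cut | no a≢b  = inj₁ (a , b , a≢b , a-cut , b-cut , among)
  ...   | yes a-cut | yes _     | yes refl = inj₂ (a , a-cut , λ w → [ id , id ]′ ∘ among w)
  ...   | yes a-cut | no ¬b-cut | _       = inj₂ (a , a-cut , only-first among ¬b-cut)
  ...   | no ¬a-cut | yes b-cut | _       =
    inj₂ (b , b-cut , only-first (λ w → ⊎-swap ∘ among w) ¬a-cut)
  ...   | no ¬a-cut | no ¬b-cut | _       =
    ⊥-elim ([ (λ { refl → ¬a-cut c-cut }) , (λ { refl → ¬b-cut c-cut }) ]′ (among c c-cut))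

  min-non-cut : ∀ X {y} → y ∈ X → ¬ IsCut G y → ∃ (IsMinNC G X)
  min-non-cut X {y} y∈X ¬cut with least Q? {toℕ y} (y , refl , y∈X , ¬cut)
    where
    Q : ℕ → Set
    Q k = ∃ λ u → toℕ u ≡ k × u ∈ X × ¬ IsCut G u
    Q? : Decidable Q
    Q? k = Fin.any? λ u → (toℕ u ℕ.≟ k) ×-dec ((u ∈? X) ×-dec ¬? (isCut? u))
  ... | _ , (u , refl , u∈X , u-¬cut) , minimal =
    u , u∈X , u-¬cut , λ w w∈X w-¬cut → ≮⇒≥ λ w<u → minimal w<u (w , refl , w∈X , w-¬cut)

  exactlyOne? : (X : Subset n) → Dec (ExactlyOne (_∈ X))
  exactlyOne? X = Fin.any? λ a → (a ∈? X) ×-dec Fin.all? λ w → (w ∈? X) →-dec (w Fin.≟ a)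

  isK11? : ∀ X P → Dec (IsK11 G X P)
  isK11? X P = exactlyOne? X ×-dec exactlyOne? P

  min-non-cut∈T : ∀ {B X P x} → IsBlock G B → IsBipartition G B X P → x ∈ X → ¬ IsCut G x →
                  ¬ (∃ λ c → c ∈ X × IsCut G c) ⊎ IsLeaf G B →
                  ∃ λ u → IsMinNC G X u × InT G u
  min-non-cut∈T {B} {X} {P} block bp x∈X ¬cut X-cut-free⊎leaf
    with min-non-cut X x∈X ¬cut
  ... | u , u-min = u , u-min , inj₂ (B , X , P , block , bp , u∈NC (isK11? X P) X-cut-free⊎leaf)
    where
    open Sides (sides bp)
    cut∈P : ¬ (∃ λ c → c ∈ X × IsCut G c) → ∀ {v} → CutIn B v → CutIn P v
    cut∈P X-cut-free {v} (v∈B , cut) with covers v v∈B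
    ... | inj₁ v∈X = ⊥-elim (X-cut-free (v , v∈X , cut))
    ... | inj₂ v∈P = v∈P , cut
    u∈NC : Dec (IsK11 G X P) → ¬ (∃ λ c → c ∈ X × IsCut G c) ⊎ IsLeaf G B → InNC G B X P u
    u∈NC (yes k11) _ = inj₁ (k11 , inj₁ u-min)
    u∈NC (no ¬k11) (inj₂ leaf) = inj₂ (inj₂ (inj₂ (¬k11 , leaf , inj₁ u-min)))
    u∈NC (no ¬k11) (inj₁ X-cut-free) with two-cuts-or-leaf block
    ... | inj₂ leaf = inj₂ (inj₂ (inj₂ (¬k11 , leaf , inj₁ u-min)))
    ... | inj₁ (a , b , a≢b , a-cut , b-cut , among) =
      inj₂ (inj₂ (inj₁ (¬k11 , (a , b , a≢b , cut∈P X-cut-free a-cut , cut∈P X-cut-free b-cut ,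
                                λ w (w∈P , cut) → among w (P⊆B w w∈P , cut)) , u-min)))

  T-on-side : ∀ {B X P x} → IsBlock G B → IsBipartition G B X P → x ∈ X → ¬ IsCut G x →
              ∃ λ w → InT G w × w ∈ X
  T-on-side {X = X} block bp x∈X ¬cut with Fin.any? (λ c → (c ∈? X) ×-dec isCut? c)
  ... | yes (c , c∈X , cut) = c , inj₁ cut , c∈X
  ... | no X-cut-free =
    let (w , (w∈X , _) , w∈T) = min-non-cut∈T block bp x∈X ¬cut (inj₁ X-cut-free) in w , w∈T , w∈X

  ¬cut⇒common-block : ∀ {x p q} → ¬ IsCut G x → E x p → E x q →
                      ∃ λ B → IsBlock G B × x ∈ B × p ∈ B × q ∈ B
  ¬cut⇒common-block ¬cut x-p x-q =
    cycle⇒block x-p x-q (proj₂ (¬cut⇒connected ¬cut _ _ (E⇒≢ x-p ∘ sym) (E⇒≢ x-q ∘ sym)))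

  -- x₁'s side contains a T-vertex, adjacent like x₁ to u and x₂ on the other side.
  T-detour : ∀ {u x₁ x₂} → ¬ IsCut G x₁ → E u x₁ → E x₁ x₂ → ∃ λ w → InT G w × E u w × E w x₂
  T-detour {u} {x₁} {x₂} ¬cut u-x₁ x₁-x₂ =
    let (B , block , x₁∈B , u∈B , x₂∈B) = ¬cut⇒common-block ¬cut (E-sym u-x₁) x₁-x₂
        (X , P , bp , x₁∈X) = orient block x₁∈B
        (w , w∈T , w∈X) = T-on-side block bp x₁∈X ¬cut
        open Sides (sides bp)
        u∈P = X-edge⇒P x₁ u x₁∈X u∈B (E-sym u-x₁)
        x₂∈P = X-edge⇒P x₁ x₂ x₁∈X x₂∈B x₁-x₂
    in w , w∈T , complete′ u w u∈P w∈X , complete w x₂ w∈X x₂∈P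

  -- The blocks through u x₁ x₂ and through x₁ x₂ x₃ share x₁ and x₂, hence coincide.
  ¬cut-pair-shortcut : ∀ {u x₁ x₂ x₃} → ¬ IsCut G x₁ → ¬ IsCut G x₂ →
                       E u x₁ → E x₁ x₂ → E x₂ x₃ → E u x₃
  ¬cut-pair-shortcut {u} {x₁} {x₂} {x₃} ¬cut₁ ¬cut₂ u-x₁ x₁-x₂ x₂-x₃ =
    let (B , block , x₁∈B , u∈B , x₂∈B) = ¬cut⇒common-block ¬cut₁ (E-sym u-x₁) x₁-x₂
        (B′ , block′ , x₂∈B′ , x₁∈B′ , x₃∈B′) = ¬cut⇒common-block ¬cut₂ (E-sym x₁-x₂) x₂-x₃
        (X , P , bp , x₁∈X) = orient block x₁∈B
        open Sides (sides bp)
        x₃∈B = two-common⇒⊆ block block′ x₁∈B x₁∈B′ x₂∈B x₂∈B′ (E⇒≢ x₁-x₂) x₃∈B′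
        u∈P = X-edge⇒P x₁ u x₁∈X u∈B (E-sym u-x₁)
        x₂∈P = X-edge⇒P x₁ x₂ x₁∈X x₂∈B x₁-x₂
    in complete′ u x₃ u∈P (P-edge⇒X x₂ x₃ x₂∈P x₃∈B x₂-x₃)

  T-walk-from-edge : ∀ {u x v k} → InT G u → InT G v → E u x → Walk G (AllV G) x v k →
                     Walk≤ (InT G) u v (suc k)
  T-walk-from-edge u∈T v∈T u-x (here _) = 1 , ≤-refl , edge u∈T v∈T u-x
  T-walk-from-edge {x = x₁} u∈T v∈T u-x₁ (step _ x₁-x₂ p) with isCut? x₁
  ... | yes cut = Walk≤-step u∈T u-x₁ (T-walk-from-edge (inj₁ cut) v∈T x₁-x₂ p)
  ... | no ¬cut₁ with p
  ...   | here _ =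
    let (w , w∈T , u-w , w-v) = T-detour ¬cut₁ u-x₁ x₁-x₂ in
    2 , ≤-refl , step u∈T u-w (edge w∈T v∈T w-v)
  ...   | step {u = x₂} _ x₂-x₃ q with isCut? x₂
  ...     | yes cut₂ =
    let (w , w∈T , u-w , w-x₂) = T-detour ¬cut₁ u-x₁ x₁-x₂ in
    Walk≤-step u∈T u-w (Walk≤-step w∈T w-x₂ (T-walk-from-edge (inj₁ cut₂) v∈T x₂-x₃ q))
  ...     | no ¬cut₂ =
    Walk≤-weaken (n≤1+n _) (Walk≤-weaken (n≤1+n _)
      (T-walk-from-edge u∈T v∈T (¬cut-pair-shortcut ¬cut₁ ¬cut₂ u-x₁ x₁-x₂ x₂-x₃) q))

  T-walk : ∀ {u v k} → InT G u → InT G v → Walk G (AllV G) u v k → Walk≤ (InT G) u v k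
  T-walk u∈T v∈T (here _)     = 0 , z≤n , here u∈T
  T-walk u∈T v∈T (step _ e p) = T-walk-from-edge u∈T v∈T e p

  two-vertices : ∃₂ λ x y → x ≢ y
  two-vertices =
    let (_ , _ , _ , (((y , y∈B₂) , _) , _) , v , _ , v∉B₂) = two-blocks in
    v , y , λ { refl → v∉B₂ y∈B₂ }

  other-vertex : ∀ a → ∃ (a ≢_)
  other-vertex a with a Fin.≟ proj₁ two-vertices
  ... | yes refl = proj₂ two-vertices
  ... | no a≢x   = _ , a≢x

  has-neighbour : ∀ a → ∃ (E a)
  has-neighbour a =
    let (b , a≢b) = other-vertex a in first-edge (proj₂ (connected a b tt tt)) a≢b
    where
    first-edge : ∀ {b k} → Walk G (AllV G) a b k → a ≢ b → ∃ (E a)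
    first-edge (here _)     a≢b = ⊥-elim (a≢b refl)
    first-edge (step _ e _) _   = _ , e

  other-cut : ∀ {B c} → ExactlyTwo (CutIn B) → CutIn B c → ∃ λ f → CutIn B f × f ≢ c
  other-cut (a , b , a≢b , a-cut , b-cut , among) c-cut with among _ c-cut
  ... | inj₁ refl = b , b-cut , a≢b ∘ sym
  ... | inj₂ refl = a , a-cut , a≢b

  T-in-block : ∀ {B y f} → IsBlock G B → y ∈ B → ¬ IsCut G y → CutIn B f →
               ∃ λ t → InT G t × t ∈ B × t ≢ f
  T-in-block block y∈B ¬y-cut f-cut with two-cuts-or-leaf block
  ... | inj₁ two = let (t , (t∈B , t-cut) , t≢f) = other-cut two f-cut in t , inj₁ t-cut , t∈B , t≢f
  ... | inj₂ leaf =
    let (Y , F , bp , y∈Y) = orient block y∈B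
        (u , (u∈Y , ¬u-cut , _) , u∈T) = min-non-cut∈T block bp y∈Y ¬y-cut (inj₂ leaf)
    in u , u∈T , Sides.X⊆B (sides bp) u u∈Y , λ { refl → ¬u-cut (proj₂ f-cut) }

  -- Walk from w towards f; the block of its last edge y f contains a T-vertex other than f.
  T-in-component : ∀ {f w} → IsCut G f → w ≢ f → ∃ λ t → InT G t × t ≢ f × Reach (_≢ f) w t
  T-in-component {f} {w} cut w≢f with last-edge (proj₂ (connected w f tt tt)) w≢f
  ... | y , w↝y , y-f with isCut? y
  ...   | yes y-cut = y , inj₁ y-cut , E⇒≢ y-f , w↝y
  ...   | no ¬y-cut =
    let (B , block , y∈B , f∈B) = edge⇒block y-f
        (t , t∈T , t∈B , t≢f) = T-in-block block y∈B ¬y-cut (f∈B , cut)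
    in t , t∈T , t≢f , Reach-trans w↝y (block-avoid block f y∈B (E⇒≢ y-f) t∈B t≢f)

  T-beyond : ∀ {c a} → IsCut G c → a ≢ c → ∃ λ t → InT G t × t ≢ c × Separates c a t
  T-beyond cut a≢c =
    let (w , w≢c , a|w) = separated-vertex cut a≢c
        (t , t∈T , t≢c , w↝t) = T-in-component cut w≢c
    in t , t∈T , t≢c , λ a↝t → a|w (Reach-trans a↝t (Reach-sym w↝t))

  Farther : Fin n → Fin n → Set
  Farther a b = ∃ λ t → InT G t × dist a b ≤ dist t b

  farther-beyond : ∀ {a b c t} → InT G t → t ≢ c → Separates c t b →
                   dist a b ≤ dist t c + dist c b → Farther a b
  farther-beyond t∈T t≢c sep bound = _ , t∈T , ≤-trans bound (separator-dist t≢c sep)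

  module OnSide {a B X P} (¬a-cut : ¬ IsCut G a) (block : IsBlock G B)
              (bp : IsBipartition G B X P) (a∈X : a ∈ X) where
    open Sides (sides bp)

    dist-within-side : ∀ {x} → x ∈ X → dist a x ≤ 2
    dist-within-side {x} x∈X =
      let (p , p∈P) = P-inhabited in
      dist-minimal (step tt (complete a p a∈X p∈P) (edge tt tt (complete′ p x p∈P x∈X)))

    -- A non-cut u on a's side has N(u) = P ⊆ N(a); if u = b, a T-vertex beyond a cut vertex
    -- of B is at distance ≥ 2 from b, while d(a, b) ≤ 2.
    via-twin : ∀ {u} → u ∈ X → ¬ IsCut G u → InT G u → ∀ b → Farther a b
    via-twin {u} u∈X ¬u-cut u∈T b with u Fin.≟ b
    ... | no u≢b = u , u∈T , twin-dist N[u]⊆N[a] u≢b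
      where
      N[u]⊆N[a] : ∀ z → E u z → E a z
      N[u]⊆N[a] z u-z =
        complete a z a∈X (X-edge⇒P u z u∈X (¬cut⇒neighbour∈block block (X⊆B u u∈X) ¬u-cut u-z) u-z)
    ... | yes refl =
      let (c , c∈B , c-cut) = block-has-cut block
          u≢c : u ≢ c
          u≢c = λ { refl → ¬u-cut c-cut }
          (t , t∈T , t≢c , u|t) = T-beyond c-cut u≢c
      in farther-beyond t∈T t≢c (Separates-sym u|t)
           (≤-trans (dist-within-side u∈X) (+-mono-≤ (1≤dist t≢c) (1≤dist (u≢c ∘ sym))))

    cut-free-side : ¬ (∃ λ c → c ∈ X × IsCut G c) → ∀ b → Farther a b
    cut-free-side X-cut-free =
      let (u , (u∈X , ¬u-cut , _) , u∈T) = min-non-cut∈T block bp a∈X ¬a-cut (inj₁ X-cut-free)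
      in via-twin u∈X ¬u-cut u∈T

    module _ {c} (c∈X : c ∈ X) (c-cut : IsCut G c) where
      a≢c : a ≢ c
      a≢c refl = ¬a-cut c-cut

      -- The first vertex w after c on a shortest c–b walk lies on a cycle through c, p ∈ P and a,
      -- hence in B, hence in P, so that a is adjacent to w.
      geodesic-through-P : ∀ {b} → Reach (_≢ c) a b → dist a b ≤ dist c b
      geodesic-through-P {b} a↝b = first-step-in-P (geodesic-first-step c≢b)
        where
        c≢b : c ≢ b
        c≢b refl = target (proj₂ a↝b) refl
        p = proj₁ P-inhabited
        p∈P = proj₂ P-inhabited
        first-step-in-P : (∃₂ λ w k → E c w × Walk G (_≢ c) w b k × suc k ≡ dist c b) →
                          dist a b ≤ dist c b
        first-step-in-P (w , k , c-w , w↝b , k+1≡d) =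
          subst (dist a b ≤_) k+1≡d
                (dist-minimal (step tt (complete a w a∈X w∈P) (weaken (λ _ → tt) w↝b)))
          where
          p↝w : Reach (_≢ c) p w
          p↝w = Reach-trans (1 , edge (X≢P c∈X p∈P ∘ sym) a≢c (complete′ p a p∈P a∈X))
                            (Reach-trans a↝b (Reach-sym (k , w↝b)))
          w∈P : w ∈ P
          w∈P =
            let (B′ , block′ , c∈B′ , p∈B′ , w∈B′) =
                  cycle⇒block (complete c p c∈X p∈P) c-w (proj₂ p↝w)
            in X-edge⇒P c w c∈X (two-common⇒⊆ block block′ (X⊆B c c∈X) c∈B′ (P⊆B p p∈P) p∈B′
                                              (X≢P c∈X p∈P) w∈B′) c-w

      reachable-case : ∀ {b} → Reach (_≢ c) a b → Farther a b
      reachable-case a↝b =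
        let (t , t∈T , t≢c , a|t) = T-beyond c-cut a≢c in
        farther-beyond t∈T t≢c (λ t↝b → a|t (Reach-trans a↝b (Reach-sym t↝b)))
                       (≤-trans (geodesic-through-P a↝b) (m≤n+m _ _))

      FarBeyond : Fin n → Set
      FarBeyond b = ∃ λ t → InT G t × t ≢ c × 2 ≤ dist t c × Separates c t b

      far-on-side : ∀ {t b} → InT G t → t ∈ X → t ≢ c → Separates c a b → FarBeyond b
      far-on-side {t} t∈T t∈X t≢c a|b =
        t , t∈T , t≢c , 2≤dist t≢c (X-independent t c t∈X c∈X) ,
        λ t↝b → a|b (Reach-trans (block-avoid block c (X⊆B a a∈X) a≢c (X⊆B t t∈X) t≢c) t↝b)

      -- A T-vertex beyond the cut vertex f ∈ P is at distance ≥ 2 from c, via f.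
      far-across : ∀ {f b} → f ∈ P → IsCut G f → Separates c a b → FarBeyond b
      far-across {f} {b} f∈P f-cut a|b = beyond (T-beyond f-cut (X≢P a∈X f∈P))
        where
        f≢c : f ≢ c
        f≢c = X≢P c∈X f∈P ∘ sym
        beyond : (∃ λ t → InT G t × t ≢ f × Separates f a t) → FarBeyond _
        beyond (t , t∈T , t≢f , a|t) = t , t∈T , t≢c , 2≤d[t,c] , t|b
          where
          t|c : Separates f t c
          t|c t↝c = a|t (Reach-trans a↝c (Reach-sym t↝c))
            where
            a↝c : Reach (_≢ f) a c
            a↝c = block-avoid block f (X⊆B a a∈X) (X≢P a∈X f∈P) (X⊆B c c∈X) (f≢c ∘ sym)
          t≢c : t ≢ c
          t≢c refl = t|c (0 , here t≢f)
          2≤d[t,c] : 2 ≤ dist t c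
          2≤d[t,c] = ≤-trans (+-mono-≤ (1≤dist t≢f) (1≤dist f≢c)) (separator-dist t≢f t|c)
          t|b : Separates c t b
          t|b t↝b = a|b (Reach-trans a↝f (Reach-trans (Reach-sym t↝f) t↝b))
            where
            a↝f : Reach (_≢ c) a f
            a↝f = 1 , edge a≢c f≢c (complete a f a∈X f∈P)
            t↝f : Reach (_≢ c) t f
            t↝f = walk-to-separator (f≢c ∘ sym) t|c (dist-walk t f)

      far-beyond : ∀ {b} → Separates c a b → FarBeyond b
      far-beyond a|b with two-cuts-or-leaf block
      ... | inj₂ leaf =
        let (u , (u∈X , ¬u-cut , _) , u∈T) = min-non-cut∈T block bp a∈X ¬a-cut (inj₂ leaf) in
        far-on-side u∈T u∈X (λ { refl → ¬u-cut c-cut }) a|b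
      ... | inj₁ two with other-cut two (X⊆B c c∈X , c-cut)
      ...   | f , (f∈B , f-cut) , f≢c with covers f f∈B
      ...     | inj₁ f∈X = far-on-side (inj₁ f-cut) f∈X f≢c a|b
      ...     | inj₂ f∈P = far-across f∈P f-cut a|b

      separated-case : ∀ {b} → Separates c a b → Farther a b
      separated-case {b} a|b =
        let (t , t∈T , t≢c , 2≤d[t,c] , t|b) = far-beyond a|b in
        farther-beyond t∈T t≢c t|b
          (≤-trans (dist-triangle a c b)
                   (+-monoˡ-≤ (dist c b) (≤-trans (dist-within-side c∈X) 2≤d[t,c])))

    farther : ∀ b → Farther a b
    farther b with Fin.any? (λ c → (c ∈? X) ×-dec isCut? c)
    ... | no X-cut-free = cut-free-side X-cut-free b
    ... | yes (c , c∈X , c-cut) with reach? (_≢? c) a b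
    ...   | yes a↝b = reachable-case c∈X c-cut a↝b
    ...   | no a|b  = separated-case c∈X c-cut a|b

  T-farther : ∀ a b → Farther a b
  T-farther a b with isCut? a
  ... | yes a-cut = a , inj₁ a-cut , ≤-refl
  ... | no ¬a-cut =
    let (B , block , a∈B , _) = edge⇒block (proj₂ (has-neighbour a))
        (X , P , bp , a∈X) = orient block a∈B
    in OnSide.farther ¬a-cut block bp a∈X b

lemma3p7 : ∀ {n : ℕ} (G : Graph n) → InClassB G →
    ∀ (D : ℕ) → IsDiam G (AllV G) D → IsDiam G (InT G) D
lemma3p7 G ((connected , bipartite) , two-blocks , at-most-two-cuts) D
         (within-D , a₀ , b₀ , _ , _ , no-shorter) = within-D-in-T , far-pair-in-T
  where
  open Walks G
  open Distance G connected
  open ClassB G connected bipartite two-blocks at-most-two-cuts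

  within-D-in-T : ∀ u v → InT G u → InT G v → ∃ λ k → k ≤ D × Walk G (InT G) u v k
  within-D-in-T u v u∈T v∈T =
    let (k , k≤D , w) = within-D u v tt tt
        (j , j≤k , w′) = T-walk u∈T v∈T w
    in j , ≤-trans j≤k k≤D , w′

  far-pair-in-T : ∃₂ λ u v → InT G u × InT G v × (∀ k → k < D → ¬ Walk G (InT G) u v k)
  far-pair-in-T =
    let (t₁ , t₁∈T , d[a₀,b₀]≤d[t₁,b₀]) = T-farther a₀ b₀
        (t₂ , t₂∈T , d[b₀,t₁]≤d[t₂,t₁]) = T-farther b₀ t₁
        D≤d[t₂,t₁] : D ≤ dist t₂ t₁
        D≤d[t₂,t₁] = begin
          D             ≤⟨ ≮⇒≥ (λ d<D → no-shorter _ d<D (dist-walk a₀ b₀)) ⟩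
          dist a₀ b₀    ≤⟨ d[a₀,b₀]≤d[t₁,b₀] ⟩
          dist t₁ b₀    ≤⟨ dist-sym b₀ t₁ ⟩
          dist b₀ t₁    ≤⟨ d[b₀,t₁]≤d[t₂,t₁] ⟩
          dist t₂ t₁    ∎
    in t₂ , t₁ , t₂∈T , t₁∈T , λ k k<D w → <⇒≱ (<-≤-trans k<D D≤d[t₂,t₁]) (dist-minimal w)
    where open ≤-Reasoning
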